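{- Let $(n,k,t,\lambda,\mu)$ be the parameter set of a (directed or undirected) strongly regular graph. Then there are at most two pairs $(a,b)$ of positive integers with $ab=n$ satisfying $2k+\mu-\lambda=a\mu+b$.
   Context: A directed strongly regular graph (DSRG) with parameters $(n,k,t,\lambda,\mu)$ is a loopless digraph on $n$ vertices whose adjacency matrix $A$ satisfies $AJ=JA=kJ$ and $A^2=tI+\lambda A+\mu(J-I-A)$; an undirected strongly regular graph $(n,k,\lambda,\mu)$ is regarded as a DSRG $(n,k,k,\lambda,\mu)$. -}

module Defs where

open import Data.Nat using (ℕ; _+_; _*_)
open import Data.Bool using (Bool; true; false; _∧_; T)
open import Data.Fin using (Fin)
open import Data.Vec using (countᵇ; allFin)
open import Data.Product using (_×_; Σ)
open import Relation.Binary.PropositionalEquality using (_≡_; _≢_)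
open import Relation.Nullary using (¬_)

Digraph : ℕ → Set
Digraph n = Fin n → Fin n → Bool

outdeg : ∀ {n} → Digraph n → Fin n → ℕ
outdeg {n} A x = countᵇ (λ z → A x z) (allFin n)

indeg : ∀ {n} → Digraph n → Fin n → ℕ
indeg {n} A y = countᵇ (λ z → A z y) (allFin n)

-- (A²)_{xy} = number of z with x → z → y
paths2 : ∀ {n} → Digraph n → Fin n → Fin n → ℕ
paths2 {n} A x y = countᵇ (λ z → A x z ∧ A z y) (allFin n)

-- A is the adjacency matrix of a DSRG (n,k,t,λ,μ):
--  loopless, AJ = JA = kJ, and A² = tI + λA + μ(J - I - A), entrywise.
record IsDSRG (n k t λ' μ : ℕ) (A : Digraph n) : Set where
  field
    loopless : ∀ x → A x x ≡ false
    outReg   : ∀ x → outdeg A x ≡ k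
    inReg    : ∀ y → indeg A y ≡ k
    diag     : ∀ x → paths2 A x x ≡ t
    adj      : ∀ x y → x ≢ y → A x y ≡ true → paths2 A x y ≡ λ'
    nonadj   : ∀ x y → x ≢ y → A x y ≡ false → paths2 A x y ≡ μ

-- (n,k,t,λ,μ) is the parameter set of some DSRG (undirected SRGs are the case t = k).
DSRGParams : ℕ → ℕ → ℕ → ℕ → ℕ → Set
DSRGParams n k t λ' μ = Σ (Digraph n) (IsDSRG n k t λ' μ)

module Submission where

-- Write c = 2k + μ − λ.  A pair (a , b) is a candidate when
-- a·b = n and a·μ + b = c; the graph structure plays no further role, so
-- the theorem is a statement about such pairs for arbitrary n, μ, c.
--
-- Two candidates with the same a coincide (b is then forced by a·μ + b = c).
-- For two candidates (a , b), (a' , b') with a ≠ a', say a' = a + d with d > 0,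
-- subtracting the linear equations gives b = d·μ + b'; substituting into
-- a·b = a'·b' gives d·(a·μ) = d·b', hence b' = a·μ and b = a'·μ: each
-- candidate's b is μ times the other's a.  Given three candidates with
-- pairwise distinct first components, b₁ = a₂·μ = a₃·μ with b₁ > 0, so
-- μ ≠ 0 and a₂ = a₃, a contradiction.

open import Defs
open import Data.Nat using (ℕ; suc; _+_; _*_; _>_; _<_; _≟_)
open import Data.Nat.Properties
  using (+-cancelˡ-≡; +-cancelʳ-≡; *-cancelˡ-≡; *-cancelʳ-≡; *-zeroʳ; +-suc;
         <-cmp; <-irrefl; m≤n⇒∃[o]m+o≡n)
open import Data.Nat.Tactic.RingSolver using (solve)
open import Data.Integer using (+_; _-_)
open import Data.Integer.Properties using (+-injective)
open import Data.List using (_∷_; [])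
open import Data.Product using (_×_; _,_; ∃; proj₁)
open import Data.Sum using (_⊎_; inj₁; inj₂)
open import Data.Empty using (⊥-elim)
open import Relation.Nullary using (¬_; yes; no)
open import Relation.Binary using (tri<; tri≈; tri>)
open import Relation.Binary.PropositionalEquality
  using (_≡_; refl; sym; trans; cong; module ≡-Reasoning)

Candidate : (n μ c a b : ℕ) → Set
Candidate n μ c a b = a * b ≡ n × a * μ + b ≡ c

<⇒positiveGap : ∀ {m n} → m < n → ∃ λ d → m + suc d ≡ n
<⇒positiveGap {m} m<n with m≤n⇒∃[o]m+o≡n m<n
... | d , 1+m+d≡n = d , trans (+-suc m d) 1+m+d≡n

sameSlope : ∀ {μ a b a' b'} → a ≡ a' → a * μ + b ≡ a' * μ + b' →
            (a , b) ≡ (a' , b')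
sameSlope {μ} {a} refl eq = cong (a ,_) (+-cancelˡ-≡ (a * μ) _ _ eq)

partnersOfGap : ∀ a d μ b b' →
                a * μ + b ≡ (a + suc d) * μ + b' → a * b ≡ (a + suc d) * b' →
                b' ≡ a * μ × b ≡ (a + suc d) * μ
partnersOfGap a d μ b b' linear product = b'≡aμ , b≡a'μ
  where
  open ≡-Reasoning

  gap : b ≡ suc d * μ + b'
  gap = +-cancelˡ-≡ (a * μ) _ _ (begin
    a * μ + b                 ≡⟨ linear ⟩
    (a + suc d) * μ + b'      ≡⟨ solve (a ∷ d ∷ μ ∷ b' ∷ []) ⟩
    a * μ + (suc d * μ + b')  ∎)

  scaled : suc d * (a * μ) ≡ suc d * b'
  scaled = +-cancelʳ-≡ (a * b') _ _ (begin
    suc d * (a * μ) + a * b'  ≡⟨ solve (a ∷ d ∷ μ ∷ b' ∷ []) ⟩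
    a * (suc d * μ + b')      ≡⟨ cong (a *_) (sym gap) ⟩
    a * b                     ≡⟨ product ⟩
    (a + suc d) * b'          ≡⟨ solve (a ∷ d ∷ μ ∷ b' ∷ []) ⟩
    suc d * b' + a * b'       ∎)

  b'≡aμ : b' ≡ a * μ
  b'≡aμ = sym (*-cancelˡ-≡ (a * μ) b' (suc d) scaled)

  b≡a'μ : b ≡ (a + suc d) * μ
  b≡a'μ = begin
    b                 ≡⟨ gap ⟩
    suc d * μ + b'    ≡⟨ cong (_+_ (suc d * μ)) b'≡aμ ⟩
    suc d * μ + a * μ ≡⟨ solve (a ∷ d ∷ μ ∷ b' ∷ []) ⟩
    (a + suc d) * μ   ∎

distinctPartners : ∀ {μ a b a' b'} → ¬ a ≡ a' →
                   a * μ + b ≡ a' * μ + b' → a * b ≡ a' * b' →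
                   b ≡ a' * μ × b' ≡ a * μ
distinctPartners {μ} {a} {b} {a'} {b'} a≢a' linear product with <-cmp a a'
... | tri≈ _ a≡a' _ = ⊥-elim (a≢a' a≡a')
... | tri< a<a' _ _ with <⇒positiveGap a<a'
...   | d , refl = let b'≡aμ , b≡a'μ = partnersOfGap a d μ b b' linear product
                   in b≡a'μ , b'≡aμ
distinctPartners {μ} {a} {b} {a'} {b'} _ linear product | tri> _ _ a'<a
  with <⇒positiveGap a'<a
... | d , refl = partnersOfGap a' d μ b' b (sym linear) (sym product)

uniqueCofactor : ∀ {b x y} μ → b > 0 → b ≡ x * μ → b ≡ y * μ → x ≡ y
uniqueCofactor {b} {x} 0 b>0 b≡xμ _ =
  ⊥-elim (<-irrefl (sym (trans b≡xμ (*-zeroʳ x))) b>0)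
uniqueCofactor {x = x} {y} (suc μ) _ b≡xμ b≡yμ =
  *-cancelʳ-≡ x y (suc μ) (trans (sym b≡xμ) b≡yμ)

atMostTwoCandidates : ∀ {n μ c a₁ b₁ a₂ b₂ a₃ b₃} → b₁ > 0 →
  Candidate n μ c a₁ b₁ → Candidate n μ c a₂ b₂ → Candidate n μ c a₃ b₃ →
  ((a₁ , b₁) ≡ (a₂ , b₂)) ⊎ ((a₁ , b₁) ≡ (a₃ , b₃)) ⊎ ((a₂ , b₂) ≡ (a₃ , b₃))
atMostTwoCandidates {μ = μ} {a₁ = a₁} {a₂ = a₂} {a₃ = a₃} b₁>0
                    (n₁ , c₁) (n₂ , c₂) (n₃ , c₃)
  with a₁ ≟ a₂ | a₁ ≟ a₃ | a₂ ≟ a₃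
... | yes a₁≡a₂ | _ | _ = inj₁ (sameSlope a₁≡a₂ (trans c₁ (sym c₂)))
... | no _ | yes a₁≡a₃ | _ = inj₂ (inj₁ (sameSlope a₁≡a₃ (trans c₁ (sym c₃))))
... | no _ | no _ | yes a₂≡a₃ = inj₂ (inj₂ (sameSlope a₂≡a₃ (trans c₂ (sym c₃))))
... | no a₁≢a₂ | no a₁≢a₃ | no a₂≢a₃ = ⊥-elim (a₂≢a₃ (uniqueCofactor μ b₁>0
        (proj₁ (distinctPartners a₁≢a₂ (trans c₁ (sym c₂)) (trans n₁ (sym n₂))))
        (proj₁ (distinctPartners a₁≢a₃ (trans c₁ (sym c₃)) (trans n₁ (sym n₃))))))

-- Corollary 5: each pair is a candidate for c = a₁·μ + b₁, the common value
-- of 2k + μ − λ.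
corollary5 : ∀ (n k t λ' μ : ℕ) → DSRGParams n k t λ' μ →
    ∀ (a₁ b₁ a₂ b₂ a₃ b₃ : ℕ) →
    a₁ > 0 → b₁ > 0 → a₁ * b₁ ≡ n → (+ (2 * k + μ) - + λ') ≡ + (a₁ * μ + b₁) →
    a₂ > 0 → b₂ > 0 → a₂ * b₂ ≡ n → (+ (2 * k + μ) - + λ') ≡ + (a₂ * μ + b₂) →
    a₃ > 0 → b₃ > 0 → a₃ * b₃ ≡ n → (+ (2 * k + μ) - + λ') ≡ + (a₃ * μ + b₃) →
    ((a₁ , b₁) ≡ (a₂ , b₂)) ⊎ ((a₁ , b₁) ≡ (a₃ , b₃)) ⊎ ((a₂ , b₂) ≡ (a₃ , b₃))
corollary5 n k t λ' μ _ a₁ b₁ a₂ b₂ a₃ b₃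
           _ b₁>0 n₁ c₁ _ _ n₂ c₂ _ _ n₃ c₃ =
  atMostTwoCandidates b₁>0 (n₁ , refl) (n₂ , sameValue c₂) (n₃ , sameValue c₃)
  where
  sameValue : ∀ {m} → (+ (2 * k + μ) - + λ') ≡ + m → m ≡ a₁ * μ + b₁
  sameValue cₘ = +-injective (trans (sym cₘ) c₁)
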